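{- Let $g=\sum_{i,j\in[n]}a_{ij}\big(x_{i\to j}-\frac1n\big)$ with arbitrary real coefficients $a_{ij}$. Then $\|g\|_2^2\le\frac8n\sum_{i,j}a_{ij}^2$.
   Context: $x_{i\to j}(\pi)=1_{\pi(i)=j}$ for $\pi\in S_n$, and $\|g\|_2^2=\mathbb{E}_{\pi\sim S_n}[g(\pi)^2]$.
   Formalization: The coefficients $a_{ij}$ are rational rather than arbitrary real numbers. -}

module Defs where

open import Data.Nat as ℕ using (ℕ; zero; suc; NonZero; _!)
open import Data.Integer using (+_)
open import Data.Fin using (Fin; _≟_)
open import Data.Fin.Properties using () renaming (_≟_ to _≟F_)
open import Data.List using (List; []; _∷_; map; concatMap; filter; length; foldr; allFin)
open import Data.Vec using (Vec; []; _∷_; lookup; toList)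
open import Data.Rational using (ℚ; 0ℚ; 1ℚ; _+_; _-_; _*_; _/_; _≤_)
import Data.List.Relation.Unary.Unique.DecPropositional as UniqueDec
open import Relation.Nullary.Decidable using (does)
open import Data.Bool using (true; false)

sumℚ : List ℚ → ℚ
sumℚ = foldr _+_ 0ℚ

Σ[_]_ : (n : ℕ) → (Fin n → ℚ) → ℚ
Σ[ n ] f = sumℚ (map f (allFin n))

allVecs : (k n : ℕ) → List (Vec (Fin n) k)
allVecs zero    n = [] ∷ []
allVecs (suc k) n = concatMap (λ v → map (λ j → j ∷ v) (allFin n)) (allVecs k n)

-- S_n: a permutation π is represented by the vector (π(0),…,π(n-1)) with
-- pairwise distinct entries; this list contains each permutation exactly once.
Sym : (n : ℕ) → List (Vec (Fin n) n)
Sym n = filter (λ v → unique? (toList v)) (allVecs n n)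
  where open UniqueDec (_≟F_ {n})

x[_⇒_] : {n : ℕ} → Fin n → Fin n → Vec (Fin n) n → ℚ
x[ i ⇒ j ] π with does (lookup π i ≟F j)
... | true  = 1ℚ
... | false = 0ℚ

𝔼 : (n : ℕ) → (Vec (Fin n) n → ℚ) → ℚ
𝔼 n h = sumℚ (map h (Sym n)) * (+ 1 / (n !)) {{n !≢0}}
  where open import Data.Nat.Properties using (_!≢0)

gFun : (n : ℕ) .{{_ : NonZero n}} → (Fin n → Fin n → ℚ) → Vec (Fin n) n → ℚ
gFun n a π = Σ[ n ] (λ i → Σ[ n ] (λ j → a i j * (x[ i ⇒ j ] π - + 1 / n)))

norm2² : (n : ℕ) → (Vec (Fin n) n → ℚ) → ℚ
norm2² n h = 𝔼 n (λ π → h π * h π)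

module Submission where

-- Centre the rows, u i j = a i j - (1/n) Σ_l a i l, so that g π = Σ_i u i (π i) and every row of u
-- sums to zero. By transposition symmetry, π i = j for exactly (n-1)! permutations π, and for
-- i ≢ k, j ≢ l exactly (n-2)! permutations send i to j and k to l. Expanding g² with these counts,
-- the zero row sums kill all mixed terms except the collisions j = l, leaving
--   Σ_π g(π)² = ((n-1)! + (n-2)!) Σ_{i,j} u_ij² - (n-2)! Σ_j (Σ_i u_ij)²
--            ≤ ((n-1)! + (n-2)!) Σ_{i,j} a_ij²,
-- and ((n-1)! + (n-2)!) / n! ≤ 2/n.

open import Defs

open import Algebra.Bundles using (CommutativeMonoid)
open import Data.Bool.Base using (true; false; if_then_else_)
open import Data.Empty using (⊥-elim)
open import Data.Fin.Base using (Fin; zero; suc)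
open import Data.Fin.Permutation using (Permutation′; _⟨$⟩ʳ_; _⟨$⟩ˡ_; inverseˡ; inverseʳ; transpose)
import Data.Fin.Permutation.Components as PC
open import Data.Fin.Properties using (_≟_)
open import Data.Integer.Base as ℤ using (+_)
import Data.Integer.Properties as ℤ
open import Data.Integer.Solver renaming (module +-*-Solver to ℤ-Solver)
open import Data.List.Base using (List; []; _∷_; map; concatMap; filter; allFin; length; _++_)
open import Data.List.Membership.Propositional using (_∈_; _∉_)
import Data.List.Properties as List
import Data.List.Relation.Unary.All as All
open import Data.List.Relation.Unary.All.Properties using (¬Any⇒All¬; All¬⇒¬Any)
open import Data.List.Relation.Unary.Any using (here; there; any?)
import Data.List.Relation.Unary.Unique.DecPropositional as UniqueDec
open import Data.List.Relation.Unary.Unique.Propositional using (Unique; _∷_)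
import Data.List.Relation.Unary.Unique.Propositional.Properties as Unique
open import Data.Nat.Base as ℕ using (ℕ; zero; suc; NonZero; _!; _∸_)
open import Data.Nat.Properties using (_!≢0)
import Data.Nat.Properties as ℕ
open import Data.Nat.Solver renaming (module +-*-Solver to ℕ-Solver)
open import Data.Rational.Base using (ℚ; 0ℚ; 1ℚ; _+_; _-_; -_; _*_; _/_; _≤_; toℚᵘ; NonNegative; nonNegative)
open import Data.Rational.Properties hiding (_≟_)
open import Data.Rational.Solver renaming (module +-*-Solver to ℚ-Solver)
open import Data.Rational.Unnormalised.Base as ℚᵘ using (mkℚᵘ; *≡*; *≤*) renaming (_≃_ to _≃ᵘ_)
import Data.Rational.Unnormalised.Properties as ℚᵘ
open import Data.Sum.Base using (inj₁; inj₂)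
open import Data.Vec.Base as Vec using (Vec; []; _∷_; lookup; toList)
open import Data.Vec.Membership.Propositional.Properties using (∈-lookup; ∈-toList⁺)
import Data.Vec.Properties as Vec
open import Function.Base using (_∘_; id)
open import Function.Bundles using (mk⇔; Injection)
open import Function.Properties.Inverse using (↔⇒↣)
open import Relation.Binary.PropositionalEquality
open import Relation.Nullary using (Dec; yes; no; does; ¬_)
open import Relation.Nullary.Decidable using (dec-true; dec-false; does-⇔)
open import Relation.Unary using (Pred; Decidable)

open import Algebra.Properties.CommutativeMonoid.Sum +-0-commutativeMonoid using (sum; sum-permute)
open import Algebra.Properties.CommutativeSemigroup (CommutativeMonoid.commutativeSemigroup +-0-commutativeMonoid)
  using () renaming (interchange to +-interchange)
open import Algebra.Properties.CommutativeSemigroup (CommutativeMonoid.commutativeSemigroup *-1-commutativeMonoid)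
  using () renaming (interchange to *-interchange)

fromℕ : ℕ → ℚ
fromℕ m = + m / 1

toℚᵘ-/ : ∀ a d .{{_ : NonZero d}} → toℚᵘ (+ a / d) ≃ᵘ mkℚᵘ (+ a) (ℕ.pred d)
toℚᵘ-/ a (suc d) = toℚᵘ-fromℚᵘ (mkℚᵘ (+ a) d)

fromℕ-+ : ∀ a b → fromℕ (a ℕ.+ b) ≡ fromℕ a + fromℕ b
fromℕ-+ a b = toℚᵘ-injective (begin
  toℚᵘ (fromℕ (a ℕ.+ b))              ≈⟨ toℚᵘ-/ (a ℕ.+ b) 1 ⟩
  mkℚᵘ (+ (a ℕ.+ b)) 0                ≈⟨ *≡* (solve 2 (λ x y → (x :+ y) :* con (+ 1) := (x :* con (+ 1) :+ y :* con (+ 1)) :* con (+ 1))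
                                                     refl (+ a) (+ b)) ⟩
  mkℚᵘ (+ a) 0 ℚᵘ.+ mkℚᵘ (+ b) 0      ≈⟨ ℚᵘ.+-cong (toℚᵘ-/ a 1) (toℚᵘ-/ b 1) ⟨
  toℚᵘ (fromℕ a) ℚᵘ.+ toℚᵘ (fromℕ b)  ≈⟨ toℚᵘ-homo-+ (fromℕ a) (fromℕ b) ⟨
  toℚᵘ (fromℕ a + fromℕ b)            ∎)
  where
  open ℚᵘ.≃-Reasoning
  open ℤ-Solver

fromℕ-* : ∀ a b → fromℕ (a ℕ.* b) ≡ fromℕ a * fromℕ b
fromℕ-* a b = toℚᵘ-injective (begin
  toℚᵘ (fromℕ (a ℕ.* b))              ≈⟨ toℚᵘ-/ (a ℕ.* b) 1 ⟩
  mkℚᵘ (+ (a ℕ.* b)) 0                ≈⟨ *≡* (cong (ℤ._* + 1) (ℤ.pos-* a b)) ⟩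
  mkℚᵘ (+ a) 0 ℚᵘ.* mkℚᵘ (+ b) 0      ≈⟨ ℚᵘ.*-cong (toℚᵘ-/ a 1) (toℚᵘ-/ b 1) ⟨
  toℚᵘ (fromℕ a) ℚᵘ.* toℚᵘ (fromℕ b)  ≈⟨ toℚᵘ-homo-* (fromℕ a) (fromℕ b) ⟨
  toℚᵘ (fromℕ a * fromℕ b)            ∎)
  where open ℚᵘ.≃-Reasoning

fromℕ-*-/ : ∀ a d .{{_ : NonZero d}} → fromℕ a * (+ 1 / d) ≡ + a / d
fromℕ-*-/ a (suc d) = toℚᵘ-injective (begin
  toℚᵘ (fromℕ a * (+ 1 / suc d))              ≈⟨ toℚᵘ-homo-* (fromℕ a) (+ 1 / suc d) ⟩
  toℚᵘ (fromℕ a) ℚᵘ.* toℚᵘ (+ 1 / suc d)      ≈⟨ ℚᵘ.*-cong (toℚᵘ-/ a 1) (toℚᵘ-/ 1 (suc d)) ⟩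
  mkℚᵘ (+ a) 0 ℚᵘ.* mkℚᵘ (+ 1) d              ≈⟨ *≡* (trans (solve 2 (λ x y → (x :* con (+ 1)) :* y := x :* y)
                                                                   refl (+ a) (+ suc d))
                                                            (cong (λ m → + a ℤ.* + m) (sym (ℕ.*-identityˡ (suc d))))) ⟩
  mkℚᵘ (+ a) d                                ≈⟨ toℚᵘ-/ a (suc d) ⟨
  toℚᵘ (+ a / suc d)                          ∎)
  where
  open ℚᵘ.≃-Reasoning
  open ℤ-Solver

n/n≡1 : ∀ n .{{_ : NonZero n}} → + n / n ≡ 1ℚ
n/n≡1 (suc d) = toℚᵘ-injective (ℚᵘ.≃-trans (toℚᵘ-/ (suc d) (suc d)) (*≡* (ℤ.*-comm (+ suc d) (+ 1))))

/≤/-cross : ∀ a b d e .{{_ : NonZero d}} .{{_ : NonZero e}} → a ℕ.* e ℕ.≤ b ℕ.* d → + a / d ≤ + b / e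
/≤/-cross a b (suc d) (suc e) ae≤bd = toℚᵘ-cancel-≤ (begin
  toℚᵘ (+ a / suc d)  ≃⟨ toℚᵘ-/ a (suc d) ⟩
  mkℚᵘ (+ a) d        ≤⟨ *≤* (subst₂ ℤ._≤_ (ℤ.pos-* a (suc e)) (ℤ.pos-* b (suc d)) (ℤ.+≤+ ae≤bd)) ⟩
  mkℚᵘ (+ b) e        ≃⟨ toℚᵘ-/ b (suc e) ⟨
  toℚᵘ (+ b / suc e)  ∎)
  where open ℚᵘ.≤-Reasoning

+/-nonNeg : ∀ a d .{{_ : NonZero d}} → 0ℚ ≤ + a / d
+/-nonNeg a d = nonNegative⁻¹ (+ a / d) {{normalize-nonNeg a d}}

fromℕ-suc : ∀ m → fromℕ (suc m) ≡ 1ℚ + fromℕ m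
fromℕ-suc = fromℕ-+ 1

fromℕ-+-∸ : ∀ m d → fromℕ (m ℕ.+ d) - fromℕ m ≡ fromℕ d
fromℕ-+-∸ m d = trans (cong (_- fromℕ m) (fromℕ-+ m d)) (solve 2 (λ x y → x :+ y :- x := y) refl (fromℕ m) (fromℕ d))
  where open ℚ-Solver

fromℕ-*-inverse : ∀ n .{{_ : NonZero n}} → fromℕ n * (+ 1 / n) ≡ 1ℚ
fromℕ-*-inverse n = trans (fromℕ-*-/ n n) (n/n≡1 n)

fromℕ-*-cancelˡ : ∀ n .{{_ : NonZero n}} {x y} → fromℕ n * x ≡ fromℕ n * y → x ≡ y
fromℕ-*-cancelˡ n {x} {y} nx≡ny = trans (sym (undo x)) (trans (cong (_*_ (+ 1 / n)) nx≡ny) (undo y))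
  where
  undo : ∀ z → + 1 / n * (fromℕ n * z) ≡ z
  undo z = begin
    + 1 / n * (fromℕ n * z)  ≡⟨ *-assoc (+ 1 / n) (fromℕ n) z ⟨
    + 1 / n * fromℕ n * z    ≡⟨ cong (_* z) (trans (*-comm (+ 1 / n) (fromℕ n)) (fromℕ-*-inverse n)) ⟩
    1ℚ * z                   ≡⟨ *-identityˡ z ⟩
    z                        ∎
    where open ≡-Reasoning

*-nonNeg : ∀ {p q} → 0ℚ ≤ p → 0ℚ ≤ q → 0ℚ ≤ p * q
*-nonNeg {p} {q} 0≤p 0≤q = nonNegative⁻¹ (p * q) {{nonNeg*nonNeg⇒nonNeg p {{nonNegative 0≤p}} q {{nonNegative 0≤q}}}}

p*p-nonNeg : ∀ p → 0ℚ ≤ p * p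
p*p-nonNeg p with ≤-total 0ℚ p
... | inj₁ 0≤p = *-nonNeg 0≤p 0≤p
... | inj₂ p≤0 = subst (0ℚ ≤_) (solve 1 (λ x → (:- x) :* (:- x) := x :* x) refl p)
                   (*-nonNeg (neg-antimono-≤ p≤0) (neg-antimono-≤ p≤0))
  where open ℚ-Solver

p-q≤p : ∀ p {q} → 0ℚ ≤ q → p - q ≤ p
p-q≤p p {q} 0≤q = subst (p - q ≤_) (solve 2 (λ p q → p :- q :+ q := p) refl p q)
  (subst (_≤ p - q + q) (+-identityʳ (p - q)) (+-monoʳ-≤ (p - q) 0≤q))
  where open ℚ-Solver

∑ : ∀ {a} {A : Set a} → List A → (A → ℚ) → ℚ
∑ xs f = sumℚ (map f xs)

𝟙 : ∀ {p} {P : Set p} → Dec P → ℚ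
𝟙 P? = if does P? then 1ℚ else 0ℚ

𝟙-yes : ∀ {p} {P : Set p} (P? : Dec P) → P → 𝟙 P? ≡ 1ℚ
𝟙-yes P? p rewrite dec-true P? p = refl

𝟙-no : ∀ {p} {P : Set p} (P? : Dec P) → ¬ P → 𝟙 P? ≡ 0ℚ
𝟙-no P? ¬p rewrite dec-false P? ¬p = refl

module _ {a} {A : Set a} where

  ∑-cong : ∀ xs {f g : A → ℚ} → (∀ x → f x ≡ g x) → ∑ xs f ≡ ∑ xs g
  ∑-cong []       f≗g = refl
  ∑-cong (x ∷ xs) f≗g = cong₂ _+_ (f≗g x) (∑-cong xs f≗g)

  ∑-zero : ∀ xs → ∑ {A = A} xs (λ _ → 0ℚ) ≡ 0ℚ
  ∑-zero []       = refl
  ∑-zero (x ∷ xs) = trans (+-identityˡ _) (∑-zero xs)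

  ∑-+ : ∀ xs (f g : A → ℚ) → ∑ xs (λ x → f x + g x) ≡ ∑ xs f + ∑ xs g
  ∑-+ []       f g = refl
  ∑-+ (x ∷ xs) f g = trans (cong (_+_ (f x + g x)) (∑-+ xs f g)) (+-interchange (f x) (g x) (∑ xs f) (∑ xs g))

  ∑-neg : ∀ xs (f : A → ℚ) → ∑ xs (λ x → - f x) ≡ - ∑ xs f
  ∑-neg []       f = refl
  ∑-neg (x ∷ xs) f = trans (cong (_+_ (- f x)) (∑-neg xs f)) (sym (neg-distrib-+ (f x) (∑ xs f)))

  ∑-- : ∀ xs (f g : A → ℚ) → ∑ xs (λ x → f x - g x) ≡ ∑ xs f - ∑ xs g
  ∑-- xs f g = trans (∑-+ xs f (λ x → - g x)) (cong (_+_ (∑ xs f)) (∑-neg xs g))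

  ∑-*ˡ : ∀ xs c (f : A → ℚ) → ∑ xs (λ x → c * f x) ≡ c * ∑ xs f
  ∑-*ˡ []       c f = sym (*-zeroʳ c)
  ∑-*ˡ (x ∷ xs) c f = trans (cong (_+_ (c * f x)) (∑-*ˡ xs c f)) (sym (*-distribˡ-+ c (f x) (∑ xs f)))

  ∑-*ʳ : ∀ xs c (f : A → ℚ) → ∑ xs (λ x → f x * c) ≡ ∑ xs f * c
  ∑-*ʳ xs c f = trans (∑-cong xs (λ x → *-comm (f x) c)) (trans (∑-*ˡ xs c f) (*-comm c (∑ xs f)))

  ∑-const : ∀ xs c → ∑ {A = A} xs (λ _ → c) ≡ fromℕ (length xs) * c
  ∑-const []       c = sym (*-zeroˡ c)
  ∑-const (x ∷ xs) c = begin
    c + ∑ xs (λ _ → c)              ≡⟨ cong (_+_ c) (∑-const xs c) ⟩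
    c + fromℕ (length xs) * c       ≡⟨ cong (_+ fromℕ (length xs) * c) (*-identityˡ c) ⟨
    1ℚ * c + fromℕ (length xs) * c  ≡⟨ *-distribʳ-+ c 1ℚ (fromℕ (length xs)) ⟨
    (1ℚ + fromℕ (length xs)) * c    ≡⟨ cong (_* c) (fromℕ-suc (length xs)) ⟨
    fromℕ (suc (length xs)) * c     ∎
    where open ≡-Reasoning

  ∑-++ : ∀ xs ys (f : A → ℚ) → ∑ (xs ++ ys) f ≡ ∑ xs f + ∑ ys f
  ∑-++ []       ys f = sym (+-identityˡ (∑ ys f))
  ∑-++ (x ∷ xs) ys f = trans (cong (_+_ (f x)) (∑-++ xs ys f)) (sym (+-assoc (f x) (∑ xs f) (∑ ys f)))

  ∑-mono-≤ : ∀ xs {f g : A → ℚ} → (∀ x → f x ≤ g x) → ∑ xs f ≤ ∑ xs g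
  ∑-mono-≤ []       f≤g = ≤-refl
  ∑-mono-≤ (x ∷ xs) f≤g = +-mono-≤ (f≤g x) (∑-mono-≤ xs f≤g)

  ∑-nonNeg : ∀ xs {f : A → ℚ} → (∀ x → 0ℚ ≤ f x) → 0ℚ ≤ ∑ xs f
  ∑-nonNeg xs {f} 0≤f = subst (_≤ ∑ xs f) (∑-zero xs) (∑-mono-≤ xs 0≤f)

  module _ {p} {P : Pred A p} (P? : Decidable P) where

    ∑-filter : ∀ xs (f : A → ℚ) → ∑ (filter P? xs) f ≡ ∑ xs (λ x → 𝟙 (P? x) * f x)
    ∑-filter []       f = refl
    ∑-filter (x ∷ xs) f with P? x
    ... | yes _ = cong₂ _+_ (sym (*-identityˡ (f x))) (∑-filter xs f)
    ... | no  _ = trans (∑-filter xs f) (trans (sym (+-identityˡ _)) (cong (_+ _) (sym (*-zeroˡ (f x)))))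

    ∑-filter-cong : ∀ xs {f g : A → ℚ} → (∀ x → P x → f x ≡ g x) → ∑ (filter P? xs) f ≡ ∑ (filter P? xs) g
    ∑-filter-cong []       f≗g = refl
    ∑-filter-cong (x ∷ xs) f≗g with P? x
    ... | yes px = cong₂ _+_ (f≗g x px) (∑-filter-cong xs f≗g)
    ... | no  _  = ∑-filter-cong xs f≗g

module _ {a b} {A : Set a} {B : Set b} where

  ∑-comm : ∀ xs ys (f : A → B → ℚ) → ∑ xs (λ x → ∑ ys (f x)) ≡ ∑ ys (λ y → ∑ xs (λ x → f x y))
  ∑-comm []       ys f = sym (∑-zero ys)
  ∑-comm (x ∷ xs) ys f = trans (cong (_+_ (∑ ys (f x))) (∑-comm xs ys f)) (sym (∑-+ ys (f x) (λ y → ∑ xs (λ x → f x y))))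

  ∑-map : ∀ xs (g : A → B) (f : B → ℚ) → ∑ (map g xs) f ≡ ∑ xs (f ∘ g)
  ∑-map xs g f = cong sumℚ (sym (List.map-∘ xs))

  ∑-concatMap : ∀ xs (g : A → List B) (f : B → ℚ) → ∑ (concatMap g xs) f ≡ ∑ xs (λ x → ∑ (g x) f)
  ∑-concatMap []       g f = refl
  ∑-concatMap (x ∷ xs) g f = trans (∑-++ (g x) (concatMap g xs) f) (cong (_+_ (∑ (g x) f)) (∑-concatMap xs g f))

  ∑-*-∑ : ∀ xs ys (f : A → ℚ) (g : B → ℚ) → ∑ xs f * ∑ ys g ≡ ∑ xs (λ x → ∑ ys (λ y → f x * g y))
  ∑-*-∑ xs ys f g = trans (sym (∑-*ʳ xs (∑ ys g) f)) (∑-cong xs (λ x → sym (∑-*ˡ ys (f x) g)))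


δ : ∀ {n} → Fin n → Fin n → ℚ
δ i j = 𝟙 (i ≟ j)

δ-refl : ∀ {n} (i : Fin n) → δ i i ≡ 1ℚ
δ-refl i = 𝟙-yes (i ≟ i) refl

δ-≢ : ∀ {n} {i j : Fin n} → i ≢ j → δ i j ≡ 0ℚ
δ-≢ {i = i} {j} = 𝟙-no (i ≟ j)

1-δ-refl : ∀ {n} (i : Fin n) → 1ℚ - δ i i ≡ 0ℚ
1-δ-refl i = trans (cong (_-_ 1ℚ) (δ-refl i)) (+-inverseʳ 1ℚ)

1-δ-≢ : ∀ {n} {i j : Fin n} → i ≢ j → 1ℚ - δ i j ≡ 1ℚ
1-δ-≢ i≢j = cong (_-_ 1ℚ) (δ-≢ i≢j)

δ-permute : ∀ {n} (σ : Permutation′ n) (i j : Fin n) → δ (σ ⟨$⟩ʳ i) j ≡ δ i (σ ⟨$⟩ˡ j)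
δ-permute σ i j with i ≟ σ ⟨$⟩ˡ j
... | yes refl   = 𝟙-yes (σ ⟨$⟩ʳ i ≟ j) (inverseʳ σ)
... | no  i≢σ⁻¹j = 𝟙-no (σ ⟨$⟩ʳ i ≟ j) (λ σi≡j → i≢σ⁻¹j (trans (sym (inverseˡ σ)) (cong (σ ⟨$⟩ˡ_) σi≡j)))

x[⇒]≡δ : ∀ {n} (i j : Fin n) (π : Vec (Fin n) n) → x[ i ⇒ j ] π ≡ δ (lookup π i) j
x[⇒]≡δ i j π with does (lookup π i ≟ j)
... | true  = refl
... | false = refl

Σ-suc : ∀ n (f : Fin (suc n) → ℚ) → Σ[ suc n ] f ≡ f zero + Σ[ n ] (f ∘ suc)
Σ-suc n f = cong (λ xs → f zero + sumℚ xs) (trans (List.map-tabulate suc f) (sym (List.map-tabulate id (f ∘ suc))))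

Σ≡sum : ∀ n (f : Fin n → ℚ) → Σ[ n ] f ≡ sum f
Σ≡sum zero    f = refl
Σ≡sum (suc n) f = trans (Σ-suc n f) (cong (_+_ (f zero)) (Σ≡sum n (f ∘ suc)))

Σ-permute : ∀ n (σ : Permutation′ n) (f : Fin n → ℚ) → Σ[ n ] (f ∘ (σ ⟨$⟩ʳ_)) ≡ Σ[ n ] f
Σ-permute n σ f = trans (Σ≡sum n (f ∘ (σ ⟨$⟩ʳ_))) (trans (sym (sum-permute f σ)) (sym (Σ≡sum n f)))

Σ-const : ∀ n c → Σ[ n ] (λ _ → c) ≡ fromℕ n * c
Σ-const n c = trans (∑-const (allFin n) c) (cong (λ m → fromℕ m * c) (List.length-tabulate {n = n} id))

Σ-δˡ : ∀ n (i : Fin n) (f : Fin n → ℚ) → Σ[ n ] (λ j → δ i j * f j) ≡ f i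
Σ-δˡ (suc n) zero f = begin
  Σ[ suc n ] (λ j → δ zero j * f j)            ≡⟨ Σ-suc n (λ j → δ zero j * f j) ⟩
  1ℚ * f zero + Σ[ n ] (λ j → 0ℚ * f (suc j))  ≡⟨ cong₂ _+_ (*-identityˡ (f zero))
                                                             (trans (∑-cong (allFin n) (λ j → *-zeroˡ (f (suc j)))) (∑-zero (allFin n))) ⟩
  f zero + 0ℚ                                  ≡⟨ +-identityʳ (f zero) ⟩
  f zero                                       ∎
  where open ≡-Reasoning
Σ-δˡ (suc n) (suc i) f = begin
  Σ[ suc n ] (λ j → δ (suc i) j * f j)            ≡⟨ Σ-suc n (λ j → δ (suc i) j * f j) ⟩
  0ℚ * f zero + Σ[ n ] (λ j → δ i j * f (suc j))  ≡⟨ cong₂ _+_ (*-zeroˡ (f zero)) (Σ-δˡ n i (f ∘ suc)) ⟩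
  0ℚ + f (suc i)                                  ≡⟨ +-identityˡ (f (suc i)) ⟩
  f (suc i)                                       ∎
  where open ≡-Reasoning

Σ-δ : ∀ n (i : Fin n) → Σ[ n ] (δ i) ≡ 1ℚ
Σ-δ n i = trans (∑-cong (allFin n) (λ j → sym (*-identityʳ (δ i j)))) (Σ-δˡ n i (λ _ → 1ℚ))

Σ-1-δ : ∀ n (j : Fin n) → Σ[ n ] (λ l → 1ℚ - δ j l) ≡ fromℕ n - 1ℚ
Σ-1-δ n j = trans (∑-- (allFin n) (λ _ → 1ℚ) (δ j)) (cong₂ _-_ (trans (Σ-const n 1ℚ) (*-identityʳ (fromℕ n))) (Σ-δ n j))

transpose-matchˡ : ∀ {n} (i j : Fin n) → PC.transpose i j i ≡ j
transpose-matchˡ i j rewrite dec-true (i ≟ i) refl = refl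

transpose-fix : ∀ {n} (i j : Fin n) {k} → k ≢ i → k ≢ j → PC.transpose i j k ≡ k
transpose-fix i j {k} k≢i k≢j rewrite dec-false (k ≟ i) k≢i | dec-false (k ≟ j) k≢j = refl

lookup-injective : ∀ {a} {A : Set a} {k} (v : Vec A k) → Unique (toList v) → ∀ {i j} → lookup v i ≡ lookup v j → i ≡ j
lookup-injective (x ∷ v) _         {zero}  {zero}  _  = refl
lookup-injective (x ∷ v) (x∉v ∷ _) {zero}  {suc j} eq = ⊥-elim (All.lookup x∉v (∈-toList⁺ (∈-lookup j v)) eq)
lookup-injective (x ∷ v) (x∉v ∷ _) {suc i} {zero}  eq = ⊥-elim (All.lookup x∉v (∈-toList⁺ (∈-lookup i v)) (sym eq))
lookup-injective (x ∷ v) (_ ∷ v!)  {suc i} {suc j} eq = cong suc (lookup-injective v v! eq)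

-- Sums over S_n

module _ {n : ℕ} where

  ∑-allVecs-suc : ∀ k (h : Vec (Fin n) (suc k) → ℚ) →
                  ∑ (allVecs (suc k) n) h ≡ ∑ (allVecs k n) (λ v → Σ[ n ] (λ j → h (j ∷ v)))
  ∑-allVecs-suc k h = trans (∑-concatMap (allVecs k n) (λ v → map (_∷ v) (allFin n)) h)
                            (∑-cong (allVecs k n) (λ v → ∑-map (allFin n) (_∷ v) h))

  ∑-allVecs-permute : ∀ k (σ : Permutation′ n) (h : Vec (Fin n) k → ℚ) →
                      ∑ (allVecs k n) (h ∘ Vec.map (σ ⟨$⟩ʳ_)) ≡ ∑ (allVecs k n) h
  ∑-allVecs-permute zero    σ h = refl
  ∑-allVecs-permute (suc k) σ h = begin
    ∑ (allVecs (suc k) n) (h ∘ Vec.map (σ ⟨$⟩ʳ_))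
      ≡⟨ ∑-allVecs-suc k _ ⟩
    ∑ (allVecs k n) (λ v → Σ[ n ] (λ j → h ((σ ⟨$⟩ʳ j) ∷ Vec.map (σ ⟨$⟩ʳ_) v)))
      ≡⟨ ∑-cong (allVecs k n) (λ v → Σ-permute n σ (λ j → h (j ∷ Vec.map (σ ⟨$⟩ʳ_) v))) ⟩
    ∑ (allVecs k n) (λ v → Σ[ n ] (λ j → h (j ∷ Vec.map (σ ⟨$⟩ʳ_) v)))
      ≡⟨ ∑-allVecs-permute k σ (λ v → Σ[ n ] (λ j → h (j ∷ v))) ⟩
    ∑ (allVecs k n) (λ v → Σ[ n ] (λ j → h (j ∷ v)))
      ≡⟨ ∑-allVecs-suc k h ⟨
    ∑ (allVecs (suc k) n) h ∎
    where open ≡-Reasoning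

  open UniqueDec (_≟_ {n}) using (unique?)

  𝟙distinct : ∀ {k} → Vec (Fin n) k → ℚ
  𝟙distinct v = 𝟙 (unique? (toList v))

  ∑-Sym : (h : Vec (Fin n) n → ℚ) → ∑ (Sym n) h ≡ ∑ (allVecs n n) (λ v → 𝟙distinct v * h v)
  ∑-Sym = ∑-filter (λ v → unique? (toList v)) (allVecs n n)

  ∑-Sym-cong : {h h′ : Vec (Fin n) n → ℚ} → (∀ π → Unique (toList π) → h π ≡ h′ π) → ∑ (Sym n) h ≡ ∑ (Sym n) h′
  ∑-Sym-cong = ∑-filter-cong (λ v → unique? (toList v)) (allVecs n n)

  𝟙distinct-permute : ∀ {k} (σ : Permutation′ n) (v : Vec (Fin n) k) → 𝟙distinct (Vec.map (σ ⟨$⟩ʳ_) v) ≡ 𝟙distinct v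
  𝟙distinct-permute σ v rewrite Vec.toList-map (σ ⟨$⟩ʳ_) v =
    cong (λ b → if b then 1ℚ else 0ℚ)
      (does-⇔ (mk⇔ Unique.map⁻ (Unique.map⁺ (Injection.injective (↔⇒↣ σ))))
              (unique? (map (σ ⟨$⟩ʳ_) (toList v))) (unique? (toList v)))

  ∑-Sym-permute : (σ : Permutation′ n) (h : Vec (Fin n) n → ℚ) → ∑ (Sym n) (h ∘ Vec.map (σ ⟨$⟩ʳ_)) ≡ ∑ (Sym n) h
  ∑-Sym-permute σ h = begin
    ∑ (Sym n) (h ∘ Vec.map (σ ⟨$⟩ʳ_))
      ≡⟨ ∑-Sym _ ⟩
    ∑ (allVecs n n) (λ v → 𝟙distinct v * h (Vec.map (σ ⟨$⟩ʳ_) v))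
      ≡⟨ ∑-cong (allVecs n n) (λ v → cong (_* h (Vec.map (σ ⟨$⟩ʳ_) v)) (sym (𝟙distinct-permute σ v))) ⟩
    ∑ (allVecs n n) ((λ v → 𝟙distinct v * h v) ∘ Vec.map (σ ⟨$⟩ʳ_))
      ≡⟨ ∑-allVecs-permute n σ (λ v → 𝟙distinct v * h v) ⟩
    ∑ (allVecs n n) (λ v → 𝟙distinct v * h v)
      ≡⟨ ∑-Sym h ⟨
    ∑ (Sym n) h ∎
    where open ≡-Reasoning

  occurrences : Fin n → List (Fin n) → ℚ
  occurrences j xs = ∑ xs (λ y → δ y j)

  occurrences-∉ : ∀ {j} xs → j ∉ xs → occurrences j xs ≡ 0ℚ
  occurrences-∉ []       j∉xs = refl
  occurrences-∉ (y ∷ xs) j∉xs = trans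
    (cong₂ _+_ (δ-≢ {i = y} (λ y≡j → j∉xs (here (sym y≡j)))) (occurrences-∉ xs (j∉xs ∘ there)))
    (+-identityʳ 0ℚ)

  occurrences-∈ : ∀ {j} xs → Unique xs → j ∈ xs → occurrences j xs ≡ 1ℚ
  occurrences-∈ (y ∷ xs) (y∉xs ∷ _) (here refl) = trans
    (cong₂ _+_ (δ-refl y) (occurrences-∉ xs (All¬⇒¬Any y∉xs)))
    (+-identityʳ 1ℚ)
  occurrences-∈ (y ∷ xs) (y∉xs ∷ xs!) (there j∈xs) = trans
    (cong₂ _+_ (δ-≢ {i = y} (λ { refl → All¬⇒¬Any y∉xs j∈xs })) (occurrences-∈ xs xs! j∈xs))
    (+-identityˡ 1ℚ)

  Σ-occurrences : ∀ xs → Σ[ n ] (λ j → occurrences j xs) ≡ fromℕ (length xs)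
  Σ-occurrences xs = begin
    Σ[ n ] (λ j → ∑ xs (λ y → δ y j))  ≡⟨ ∑-comm (allFin n) xs (λ j y → δ y j) ⟩
    ∑ xs (λ y → Σ[ n ] (δ y))          ≡⟨ ∑-cong xs (Σ-δ n) ⟩
    ∑ xs (λ _ → 1ℚ)                    ≡⟨ ∑-const xs 1ℚ ⟩
    fromℕ (length xs) * 1ℚ             ≡⟨ *-identityʳ _ ⟩
    fromℕ (length xs)                  ∎
    where open ≡-Reasoning

  𝟙distinct-∷ : ∀ {k} j (v : Vec (Fin n) k) → 𝟙distinct (j ∷ v) ≡ 𝟙distinct v * (1ℚ - occurrences j (toList v))
  𝟙distinct-∷ j v = go (unique? xs) (any? (j ≟_) xs)
    where
    xs = toList v
    go : Dec (Unique xs) → Dec (j ∈ xs) → 𝟙 (unique? (j ∷ xs)) ≡ 𝟙 (unique? xs) * (1ℚ - occurrences j xs)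
    go (no ¬xs!) _ = trans (𝟙-no (unique? (j ∷ xs)) (λ { (_ ∷ xs!) → ¬xs! xs! }))
      (sym (trans (cong (_* (1ℚ - occurrences j xs)) (𝟙-no (unique? xs) ¬xs!)) (*-zeroˡ (1ℚ - occurrences j xs))))
    go (yes xs!) (yes j∈xs) = trans (𝟙-no (unique? (j ∷ xs)) (λ { (j∉xs ∷ _) → All¬⇒¬Any j∉xs j∈xs }))
      (sym (trans (cong₂ (λ d o → d * (1ℚ - o)) (𝟙-yes (unique? xs) xs!) (occurrences-∈ xs xs! j∈xs))
                  (trans (*-identityˡ _) (+-inverseʳ 1ℚ))))
    go (yes xs!) (no j∉xs) = trans (𝟙-yes (unique? (j ∷ xs)) (¬Any⇒All¬ xs j∉xs ∷ xs!))
      (sym (trans (cong₂ (λ d o → d * (1ℚ - o)) (𝟙-yes (unique? xs) xs!) (occurrences-∉ xs j∉xs))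
                  (*-identityˡ 1ℚ)))

  #distinct : ℕ → ℚ
  #distinct k = ∑ (allVecs k n) 𝟙distinct

  #distinct-suc : ∀ k → #distinct (suc k) ≡ #distinct k * (fromℕ n - fromℕ k)
  #distinct-suc k = begin
    #distinct (suc k)                                           ≡⟨ ∑-allVecs-suc k 𝟙distinct ⟩
    ∑ (allVecs k n) (λ v → Σ[ n ] (λ j → 𝟙distinct (j ∷ v)))    ≡⟨ ∑-cong (allVecs k n) Σ-𝟙distinct-∷ ⟩
    ∑ (allVecs k n) (λ v → 𝟙distinct v * (fromℕ n - fromℕ k))  ≡⟨ ∑-*ʳ (allVecs k n) (fromℕ n - fromℕ k) 𝟙distinct ⟩
    #distinct k * (fromℕ n - fromℕ k)                           ∎
    where
    open ≡-Reasoning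
    Σ-𝟙distinct-∷ : ∀ v → Σ[ n ] (λ j → 𝟙distinct (j ∷ v)) ≡ 𝟙distinct v * (fromℕ n - fromℕ k)
    Σ-𝟙distinct-∷ v = begin
      Σ[ n ] (λ j → 𝟙distinct (j ∷ v))
        ≡⟨ ∑-cong (allFin n) (λ j → 𝟙distinct-∷ j v) ⟩
      Σ[ n ] (λ j → 𝟙distinct v * (1ℚ - occurrences j (toList v)))
        ≡⟨ trans (∑-*ˡ (allFin n) (𝟙distinct v) _) (cong (𝟙distinct v *_) (∑-- (allFin n) (λ _ → 1ℚ) _)) ⟩
      𝟙distinct v * (Σ[ n ] (λ _ → 1ℚ) - Σ[ n ] (λ j → occurrences j (toList v)))
        ≡⟨ cong₂ (λ s o → 𝟙distinct v * (s - o)) (trans (Σ-const n 1ℚ) (*-identityʳ (fromℕ n))) (Σ-occurrences (toList v)) ⟩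
      𝟙distinct v * (fromℕ n - fromℕ (length (toList v)))
        ≡⟨ cong (λ m → 𝟙distinct v * (fromℕ n - fromℕ m)) (Vec.length-toList v) ⟩
      𝟙distinct v * (fromℕ n - fromℕ k) ∎

  #distinct-! : ∀ k r → k ℕ.+ r ≡ n → #distinct k * fromℕ (r !) ≡ fromℕ (n !)
  #distinct-! zero    r refl = trans (cong (_* fromℕ (r !)) (+-identityʳ 1ℚ)) (*-identityˡ _)
  #distinct-! (suc k) r k+r≡n = begin
    #distinct (suc k) * fromℕ (r !)                  ≡⟨ cong (_* fromℕ (r !)) (#distinct-suc k) ⟩
    #distinct k * (fromℕ n - fromℕ k) * fromℕ (r !)  ≡⟨ cong (λ d → #distinct k * d * fromℕ (r !)) n-k≡1+r ⟩
    #distinct k * fromℕ (suc r) * fromℕ (r !)        ≡⟨ *-assoc (#distinct k) _ _ ⟩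
    #distinct k * (fromℕ (suc r) * fromℕ (r !))      ≡⟨ cong (#distinct k *_) (fromℕ-* (suc r) (r !)) ⟨
    #distinct k * fromℕ (suc r !)                    ≡⟨ #distinct-! k (suc r) (trans (ℕ.+-suc k r) k+r≡n) ⟩
    fromℕ (n !)                                      ∎
    where
    open ≡-Reasoning
    n-k≡1+r : fromℕ n - fromℕ k ≡ fromℕ (suc r)
    n-k≡1+r = trans (cong (λ m → fromℕ m - fromℕ k) (trans (sym k+r≡n) (sym (ℕ.+-suc k r)))) (fromℕ-+-∸ k (suc r))

  ∑-Sym-1 : ∑ (Sym n) (λ _ → 1ℚ) ≡ fromℕ (n !)
  ∑-Sym-1 = begin
    ∑ (Sym n) (λ _ → 1ℚ)                       ≡⟨ ∑-Sym (λ _ → 1ℚ) ⟩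
    ∑ (allVecs n n) (λ v → 𝟙distinct v * 1ℚ)  ≡⟨ ∑-cong (allVecs n n) (λ v → *-identityʳ (𝟙distinct v)) ⟩
    #distinct n                                ≡⟨ *-identityʳ (#distinct n) ⟨
    #distinct n * fromℕ (0 !)                  ≡⟨ #distinct-! n 0 (ℕ.+-identityʳ n) ⟩
    fromℕ (n !)                                ∎
    where open ≡-Reasoning

  δ-lookup-permute : (σ : Permutation′ n) (π : Vec (Fin n) n) (i j : Fin n) →
                     δ (lookup (Vec.map (σ ⟨$⟩ʳ_) π) i) j ≡ δ (lookup π i) (σ ⟨$⟩ˡ j)
  δ-lookup-permute σ π i j = trans (cong (λ x → δ x j) (Vec.lookup-map i (σ ⟨$⟩ʳ_) π)) (δ-permute σ (lookup π i) j)

  hits : Fin n → Fin n → ℚ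
  hits i j = ∑ (Sym n) (λ π → δ (lookup π i) j)

  hits-transpose : ∀ i j j′ → hits i j ≡ hits i j′
  hits-transpose i j j′ = begin
    ∑ (Sym n) (λ π → δ (lookup π i) j)
      ≡⟨ ∑-cong (Sym n) (λ π → cong (δ (lookup π i)) (transpose-matchˡ j′ j)) ⟨
    ∑ (Sym n) (λ π → δ (lookup π i) (σ ⟨$⟩ˡ j′))
      ≡⟨ ∑-cong (Sym n) (λ π → δ-lookup-permute σ π i j′) ⟨
    ∑ (Sym n) (λ π → δ (lookup (Vec.map (σ ⟨$⟩ʳ_) π) i) j′)
      ≡⟨ ∑-Sym-permute σ (λ π → δ (lookup π i) j′) ⟩
    ∑ (Sym n) (λ π → δ (lookup π i) j′) ∎
    where
    open ≡-Reasoning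
    σ = transpose j j′

  Σ-hits : ∀ i → Σ[ n ] (hits i) ≡ fromℕ (n !)
  Σ-hits i = begin
    Σ[ n ] (λ j → ∑ (Sym n) (λ π → δ (lookup π i) j))  ≡⟨ ∑-comm (allFin n) (Sym n) (λ j π → δ (lookup π i) j) ⟩
    ∑ (Sym n) (λ π → Σ[ n ] (δ (lookup π i)))          ≡⟨ ∑-cong (Sym n) (λ π → Σ-δ n (lookup π i)) ⟩
    ∑ (Sym n) (λ _ → 1ℚ)                               ≡⟨ ∑-Sym-1 ⟩
    fromℕ (n !)                                        ∎
    where open ≡-Reasoning

  pairHits : Fin n → Fin n → Fin n → Fin n → ℚ
  pairHits i k j l = ∑ (Sym n) (λ π → δ (lookup π i) j * δ (lookup π k) l)

  pairHits-diagonal : ∀ {i k} → i ≢ k → ∀ j → pairHits i k j j ≡ 0ℚ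
  pairHits-diagonal {i} {k} i≢k j = trans (∑-Sym-cong vanishes) (∑-zero (Sym n))
    where
    vanishes : ∀ π → Unique (toList π) → δ (lookup π i) j * δ (lookup π k) j ≡ 0ℚ
    vanishes π π! with lookup π i ≟ j
    ... | no _ = *-zeroˡ (δ (lookup π k) j)
    ... | yes πi≡j with lookup π k ≟ j
    ...   | no _     = *-zeroʳ 1ℚ
    ...   | yes πk≡j = ⊥-elim (i≢k (lookup-injective π π! (trans πi≡j (sym πk≡j))))

  pairHits-transpose : ∀ i k {j l l′} → l ≢ j → l′ ≢ j → pairHits i k j l ≡ pairHits i k j l′
  pairHits-transpose i k {j} {l} {l′} l≢j l′≢j = begin
    ∑ (Sym n) (λ π → δ (lookup π i) j * δ (lookup π k) l)
      ≡⟨ ∑-cong (Sym n) (λ π → cong₂ (λ x y → δ (lookup π i) x * δ (lookup π k) y)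
                                     (transpose-fix l′ l (l′≢j ∘ sym) (l≢j ∘ sym)) (transpose-matchˡ l′ l)) ⟨
    ∑ (Sym n) (λ π → δ (lookup π i) (σ ⟨$⟩ˡ j) * δ (lookup π k) (σ ⟨$⟩ˡ l′))
      ≡⟨ ∑-cong (Sym n) (λ π → cong₂ _*_ (δ-lookup-permute σ π i j) (δ-lookup-permute σ π k l′)) ⟨
    ∑ (Sym n) (λ π → δ (lookup (Vec.map (σ ⟨$⟩ʳ_) π) i) j * δ (lookup (Vec.map (σ ⟨$⟩ʳ_) π) k) l′)
      ≡⟨ ∑-Sym-permute σ (λ π → δ (lookup π i) j * δ (lookup π k) l′) ⟩
    ∑ (Sym n) (λ π → δ (lookup π i) j * δ (lookup π k) l′) ∎
    where
    open ≡-Reasoning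
    σ = transpose l l′

  pairHits-profile : ∀ {i k j l} → i ≢ k → l ≢ j → ∀ l′ → pairHits i k j l′ ≡ (1ℚ - δ j l′) * pairHits i k j l
  pairHits-profile {i} {k} {j} {l} i≢k l≢j l′ with l′ ≟ j
  ... | yes refl = trans (pairHits-diagonal i≢k l′)
                         (sym (trans (cong (_* pairHits i k j l) (1-δ-refl l′)) (*-zeroˡ (pairHits i k j l))))
  ... | no l′≢j = trans (pairHits-transpose i k l′≢j l≢j)
                        (sym (trans (cong (_* pairHits i k j l) (1-δ-≢ (l′≢j ∘ sym))) (*-identityˡ (pairHits i k j l))))

  Σ-pairHits : ∀ i k j → Σ[ n ] (pairHits i k j) ≡ hits i j
  Σ-pairHits i k j = begin
    Σ[ n ] (λ l → ∑ (Sym n) (λ π → δ (lookup π i) j * δ (lookup π k) l))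
      ≡⟨ ∑-comm (allFin n) (Sym n) _ ⟩
    ∑ (Sym n) (λ π → Σ[ n ] (λ l → δ (lookup π i) j * δ (lookup π k) l))
      ≡⟨ ∑-cong (Sym n) (λ π → ∑-*ˡ (allFin n) (δ (lookup π i) j) (δ (lookup π k))) ⟩
    ∑ (Sym n) (λ π → δ (lookup π i) j * Σ[ n ] (δ (lookup π k)))
      ≡⟨ ∑-cong (Sym n) (λ π → trans (cong (δ (lookup π i) j *_) (Σ-δ n (lookup π k))) (*-identityʳ _)) ⟩
    hits i j ∎
    where open ≡-Reasoning

hits≡ : ∀ {n} (i j : Fin n) → hits i j ≡ fromℕ ((n ∸ 1) !)
hits≡ {suc s} i j = fromℕ-*-cancelˡ (suc s) (begin
  fromℕ (suc s) * hits i j     ≡⟨ Σ-const (suc s) (hits i j) ⟨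
  Σ[ suc s ] (λ _ → hits i j)  ≡⟨ ∑-cong (allFin (suc s)) (hits-transpose i j) ⟩
  Σ[ suc s ] (hits i)          ≡⟨ Σ-hits i ⟩
  fromℕ (suc s !)              ≡⟨ fromℕ-* (suc s) (s !) ⟩
  fromℕ (suc s) * fromℕ (s !)  ∎)
  where open ≡-Reasoning

pairHits-offDiagonal : ∀ {t} {i k j l : Fin (suc (suc t))} → i ≢ k → l ≢ j → pairHits i k j l ≡ fromℕ (t !)
pairHits-offDiagonal {t} {i} {k} {j} {l} i≢k l≢j = fromℕ-*-cancelˡ (suc t) (begin
  fromℕ (suc t) * c                   ≡⟨ cong (_* c) (trans (Σ-1-δ n j) (fromℕ-+-∸ 1 (suc t))) ⟨
  Σ[ n ] (λ l′ → 1ℚ - δ j l′) * c     ≡⟨ ∑-*ʳ (allFin n) c (λ l′ → 1ℚ - δ j l′) ⟨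
  Σ[ n ] (λ l′ → (1ℚ - δ j l′) * c)   ≡⟨ ∑-cong (allFin n) (pairHits-profile i≢k l≢j) ⟨
  Σ[ n ] (pairHits i k j)             ≡⟨ Σ-pairHits i k j ⟩
  hits i j                            ≡⟨ hits≡ i j ⟩
  fromℕ (suc t !)                     ≡⟨ fromℕ-* (suc t) (t !) ⟩
  fromℕ (suc t) * fromℕ (t !)         ∎)
  where
  open ≡-Reasoning
  n = suc (suc t)
  c = pairHits i k j l

-- (n ∸ 2)! is a junk value for n = 1, where i ≢ k cannot hold.
pairHits≡ : ∀ {n} {i k : Fin n} → i ≢ k → ∀ j l → pairHits i k j l ≡ (1ℚ - δ j l) * fromℕ ((n ∸ 2) !)
pairHits≡ {suc zero}    {zero} {zero} i≢k j l = ⊥-elim (i≢k refl)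
pairHits≡ {suc (suc t)} i≢k j l with l ≟ j
... | yes refl = trans (pairHits-diagonal i≢k l)
                       (sym (trans (cong (_* fromℕ (t !)) (1-δ-refl l)) (*-zeroˡ (fromℕ (t !)))))
... | no l≢j  = trans (pairHits-offDiagonal i≢k l≢j)
                       (sym (trans (cong (_* fromℕ (t !)) (1-δ-≢ (l≢j ∘ sym))) (*-identityˡ (fromℕ (t !)))))

-- Moments of the entries of a random permutation
∑-Sym-lookup : ∀ {n} (i : Fin n) (F : Fin n → ℚ) → ∑ (Sym n) (λ π → F (lookup π i)) ≡ fromℕ ((n ∸ 1) !) * Σ[ n ] F
∑-Sym-lookup {n} i F = begin
  ∑ (Sym n) (λ π → F (lookup π i))                          ≡⟨ ∑-cong (Sym n) (λ π → Σ-δˡ n (lookup π i) F) ⟨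
  ∑ (Sym n) (λ π → Σ[ n ] (λ j → δ (lookup π i) j * F j))   ≡⟨ ∑-comm (Sym n) (allFin n) _ ⟩
  Σ[ n ] (λ j → ∑ (Sym n) (λ π → δ (lookup π i) j * F j))   ≡⟨ ∑-cong (allFin n) (λ j → ∑-*ʳ (Sym n) (F j) _) ⟩
  Σ[ n ] (λ j → hits i j * F j)                             ≡⟨ ∑-cong (allFin n) (λ j → cong (_* F j) (hits≡ i j)) ⟩
  Σ[ n ] (λ j → fromℕ ((n ∸ 1) !) * F j)                    ≡⟨ ∑-*ˡ (allFin n) (fromℕ ((n ∸ 1) !)) F ⟩
  fromℕ ((n ∸ 1) !) * Σ[ n ] F                              ∎
  where open ≡-Reasoning

∑-Sym-lookup-pairHits : ∀ {n} (i k : Fin n) (F G : Fin n → ℚ) →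
  ∑ (Sym n) (λ π → F (lookup π i) * G (lookup π k)) ≡ Σ[ n ] (λ j → Σ[ n ] (λ l → pairHits i k j l * (F j * G l)))
∑-Sym-lookup-pairHits {n} i k F G = begin
  ∑ (Sym n) (λ π → F (lookup π i) * G (lookup π k))
    ≡⟨ ∑-cong (Sym n) (λ π → cong₂ _*_ (Σ-δˡ n (lookup π i) F) (Σ-δˡ n (lookup π k) G)) ⟨
  ∑ (Sym n) (λ π → Σ[ n ] (λ j → δ (lookup π i) j * F j) * Σ[ n ] (λ l → δ (lookup π k) l * G l))
    ≡⟨ ∑-cong (Sym n) (λ π → ∑-*-∑ (allFin n) (allFin n) _ _) ⟩
  ∑ (Sym n) (λ π → Σ[ n ] (λ j → Σ[ n ] (λ l → (δ (lookup π i) j * F j) * (δ (lookup π k) l * G l))))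
    ≡⟨ ∑-comm (Sym n) (allFin n) _ ⟩
  Σ[ n ] (λ j → ∑ (Sym n) (λ π → Σ[ n ] (λ l → (δ (lookup π i) j * F j) * (δ (lookup π k) l * G l))))
    ≡⟨ ∑-cong (allFin n) (λ j → ∑-comm (Sym n) (allFin n) _) ⟩
  Σ[ n ] (λ j → Σ[ n ] (λ l → ∑ (Sym n) (λ π → (δ (lookup π i) j * F j) * (δ (lookup π k) l * G l))))
    ≡⟨ ∑-cong (allFin n) (λ j → ∑-cong (allFin n) (λ l → trans
         (∑-cong (Sym n) (λ π → *-interchange (δ (lookup π i) j) (F j) (δ (lookup π k) l) (G l)))
         (∑-*ʳ (Sym n) (F j * G l) _))) ⟩
  Σ[ n ] (λ j → Σ[ n ] (λ l → pairHits i k j l * (F j * G l))) ∎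
  where open ≡-Reasoning

∑-Sym-lookup-pair : ∀ {n} {i k : Fin n} → i ≢ k → (F G : Fin n → ℚ) →
  ∑ (Sym n) (λ π → F (lookup π i) * G (lookup π k)) ≡ fromℕ ((n ∸ 2) !) * (Σ[ n ] F * Σ[ n ] G - Σ[ n ] (λ j → F j * G j))
∑-Sym-lookup-pair {n} {i} {k} i≢k F G = begin
  ∑ (Sym n) (λ π → F (lookup π i) * G (lookup π k))
    ≡⟨ ∑-Sym-lookup-pairHits i k F G ⟩
  Σ[ n ] (λ j → Σ[ n ] (λ l → pairHits i k j l * (F j * G l)))
    ≡⟨ ∑-cong (allFin n) (λ j → ∑-cong (allFin n) (λ l → trans (cong (_* (F j * G l)) (pairHits≡ i≢k j l))
                                                               (rearrange (δ j l) μ (F j * G l)))) ⟩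
  Σ[ n ] (λ j → Σ[ n ] (λ l → μ * (F j * G l - δ j l * (F j * G l))))
    ≡⟨ ∑-cong (allFin n) (λ j → trans (∑-*ˡ (allFin n) μ _) (cong (μ *_) (∑-- (allFin n) _ _))) ⟩
  Σ[ n ] (λ j → μ * (Σ[ n ] (λ l → F j * G l) - Σ[ n ] (λ l → δ j l * (F j * G l))))
    ≡⟨ ∑-cong (allFin n) (λ j → cong (λ d → μ * (Σ[ n ] (λ l → F j * G l) - d)) (Σ-δˡ n j (λ l → F j * G l))) ⟩
  Σ[ n ] (λ j → μ * (Σ[ n ] (λ l → F j * G l) - F j * G j))
    ≡⟨ trans (∑-*ˡ (allFin n) μ _) (cong (μ *_) (∑-- (allFin n) _ _)) ⟩
  μ * (Σ[ n ] (λ j → Σ[ n ] (λ l → F j * G l)) - Σ[ n ] (λ j → F j * G j))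
    ≡⟨ cong (λ d → μ * (d - Σ[ n ] (λ j → F j * G j))) (∑-*-∑ (allFin n) (allFin n) F G) ⟨
  μ * (Σ[ n ] F * Σ[ n ] G - Σ[ n ] (λ j → F j * G j)) ∎
  where
  open ≡-Reasoning
  open ℚ-Solver
  μ = fromℕ ((n ∸ 2) !)
  rearrange : ∀ d m x → (1ℚ - d) * m * x ≡ m * (x - d * x)
  rearrange = solve 3 (λ d m x → (con 1ℚ :- d) :* m :* x := m :* (x :- d :* x)) refl

-- The second moment of g

module _ (n : ℕ) .{{_ : NonZero n}} where

  centre : (Fin n → ℚ) → Fin n → ℚ
  centre f j = f j - + 1 / n * Σ[ n ] f

  Σ-centre : ∀ f → Σ[ n ] (centre f) ≡ 0ℚ
  Σ-centre f = begin
    Σ[ n ] (λ j → f j - c * A)  ≡⟨ ∑-- (allFin n) f (λ _ → c * A) ⟩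
    A - Σ[ n ] (λ _ → c * A)    ≡⟨ cong (_-_ A) (Σ-const n (c * A)) ⟩
    A - fromℕ n * (c * A)       ≡⟨ cong (_-_ A) (*-assoc (fromℕ n) c A) ⟨
    A - fromℕ n * c * A         ≡⟨ cong (λ d → A - d * A) (fromℕ-*-inverse n) ⟩
    A - 1ℚ * A                  ≡⟨ solve 1 (λ x → x :- con 1ℚ :* x := con 0ℚ) refl A ⟩
    0ℚ                          ∎
    where
    open ≡-Reasoning
    open ℚ-Solver
    c = + 1 / n
    A = Σ[ n ] f

  Σ-centre² : ∀ f → Σ[ n ] (λ j → centre f j * centre f j) ≡ Σ[ n ] (λ j → f j * f j) - + 1 / n * Σ[ n ] f * Σ[ n ] f
  Σ-centre² f = begin
    Σ[ n ] (λ j → (f j - C) * (f j - C))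
      ≡⟨ ∑-cong (allFin n) (λ j → solve 2 (λ x C → (x :- C) :* (x :- C) := x :* x :- (C :* x :+ C :* (x :- C))) refl (f j) C) ⟩
    Σ[ n ] (λ j → f j * f j - (C * f j + C * centre f j))
      ≡⟨ ∑-- (allFin n) _ _ ⟩
    Σ[ n ] (λ j → f j * f j) - Σ[ n ] (λ j → C * f j + C * centre f j)
      ≡⟨ cong (_-_ (Σ[ n ] (λ j → f j * f j)))
              (trans (∑-+ (allFin n) _ _) (cong₂ _+_ (∑-*ˡ (allFin n) C f) (∑-*ˡ (allFin n) C (centre f)))) ⟩
    Σ[ n ] (λ j → f j * f j) - (C * Σ[ n ] f + C * Σ[ n ] (centre f))
      ≡⟨ cong (λ s → Σ[ n ] (λ j → f j * f j) - (C * Σ[ n ] f + C * s)) (Σ-centre f) ⟩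
    Σ[ n ] (λ j → f j * f j) - (C * Σ[ n ] f + C * 0ℚ)
      ≡⟨ cong (_-_ (Σ[ n ] (λ j → f j * f j))) (solve 2 (λ C A → C :* A :+ C :* con 0ℚ := C :* A) refl C (Σ[ n ] f)) ⟩
    Σ[ n ] (λ j → f j * f j) - C * Σ[ n ] f ∎
    where
    open ≡-Reasoning
    open ℚ-Solver
    C = + 1 / n * Σ[ n ] f

  Σ-centre²-≤ : ∀ f → Σ[ n ] (λ j → centre f j * centre f j) ≤ Σ[ n ] (λ j → f j * f j)
  Σ-centre²-≤ f = subst (_≤ Σ[ n ] (λ j → f j * f j)) (sym (Σ-centre² f))
    (p-q≤p _ (subst (0ℚ ≤_) (sym (*-assoc (+ 1 / n) (Σ[ n ] f) (Σ[ n ] f))) (*-nonNeg (+/-nonNeg 1 n) (p*p-nonNeg (Σ[ n ] f)))))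

  gFun≡Σ-centre : ∀ a π → gFun n a π ≡ Σ[ n ] (λ i → centre (a i) (lookup π i))
  gFun≡Σ-centre a π = ∑-cong (allFin n) row
    where
    open ≡-Reasoning
    open ℚ-Solver
    c = + 1 / n
    row : ∀ i → Σ[ n ] (λ j → a i j * (x[ i ⇒ j ] π - c)) ≡ centre (a i) (lookup π i)
    row i = begin
      Σ[ n ] (λ j → a i j * (x[ i ⇒ j ] π - c))
        ≡⟨ ∑-cong (allFin n) (λ j → trans (cong (λ x → a i j * (x - c)) (x[⇒]≡δ i j π))
                                          (solve 3 (λ a d c → a :* (d :- c) := d :* a :- c :* a) refl (a i j) (δ (lookup π i) j) c)) ⟩
      Σ[ n ] (λ j → δ (lookup π i) j * a i j - c * a i j)
        ≡⟨ ∑-- (allFin n) _ _ ⟩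
      Σ[ n ] (λ j → δ (lookup π i) j * a i j) - Σ[ n ] (λ j → c * a i j)
        ≡⟨ cong₂ _-_ (Σ-δˡ n (lookup π i) (a i)) (∑-*ˡ (allFin n) c (a i)) ⟩
      centre (a i) (lookup π i) ∎

module _ {n : ℕ} (u : Fin n → Fin n → ℚ) where

  private
    μ₁ μ₂ : ℚ
    μ₁ = fromℕ ((n ∸ 1) !)
    μ₂ = fromℕ ((n ∸ 2) !)

  rowDot : Fin n → Fin n → ℚ
  rowDot i k = Σ[ n ] (λ j → u i j * u k j)

  ∑-Sym-rows : (∀ i → Σ[ n ] (u i) ≡ 0ℚ) → ∀ i k →
    ∑ (Sym n) (λ π → u i (lookup π i) * u k (lookup π k)) ≡ (μ₁ + μ₂) * (δ i k * rowDot i k) - μ₂ * rowDot i k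
  ∑-Sym-rows Σu≡0 i k with i ≟ k
  ... | yes refl = begin
    ∑ (Sym n) (λ π → u i (lookup π i) * u i (lookup π i))
      ≡⟨ ∑-Sym-lookup i (λ j → u i j * u i j) ⟩
    μ₁ * rowDot i i
      ≡⟨ solve 3 (λ x y q → x :* q := (x :+ y) :* (con 1ℚ :* q) :- y :* q) refl μ₁ μ₂ (rowDot i i) ⟩
    (μ₁ + μ₂) * (1ℚ * rowDot i i) - μ₂ * rowDot i i ∎
    where
    open ≡-Reasoning
    open ℚ-Solver
  ... | no i≢k = begin
    ∑ (Sym n) (λ π → u i (lookup π i) * u k (lookup π k))
      ≡⟨ ∑-Sym-lookup-pair i≢k (u i) (u k) ⟩
    μ₂ * (Σ[ n ] (u i) * Σ[ n ] (u k) - rowDot i k)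
      ≡⟨ cong₂ (λ x y → μ₂ * (x * y - rowDot i k)) (Σu≡0 i) (Σu≡0 k) ⟩
    μ₂ * (0ℚ * 0ℚ - rowDot i k)
      ≡⟨ solve 3 (λ x y q → y :* (con 0ℚ :* con 0ℚ :- q) := (x :+ y) :* (con 0ℚ :* q) :- y :* q) refl μ₁ μ₂ (rowDot i k) ⟩
    (μ₁ + μ₂) * (0ℚ * rowDot i k) - μ₂ * rowDot i k ∎
    where
    open ≡-Reasoning
    open ℚ-Solver

  Σ-rowDot : Σ[ n ] (λ i → Σ[ n ] (rowDot i)) ≡ Σ[ n ] (λ j → Σ[ n ] (λ i → u i j) * Σ[ n ] (λ i → u i j))
  Σ-rowDot = begin
    Σ[ n ] (λ i → Σ[ n ] (λ k → Σ[ n ] (λ j → u i j * u k j)))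
      ≡⟨ ∑-cong (allFin n) (λ i → ∑-comm (allFin n) (allFin n) _) ⟩
    Σ[ n ] (λ i → Σ[ n ] (λ j → Σ[ n ] (λ k → u i j * u k j)))
      ≡⟨ ∑-comm (allFin n) (allFin n) _ ⟩
    Σ[ n ] (λ j → Σ[ n ] (λ i → Σ[ n ] (λ k → u i j * u k j)))
      ≡⟨ ∑-cong (allFin n) (λ j → ∑-*-∑ (allFin n) (allFin n) _ _) ⟨
    Σ[ n ] (λ j → Σ[ n ] (λ i → u i j) * Σ[ n ] (λ i → u i j)) ∎
    where open ≡-Reasoning

  ∑-Sym-square : (∀ i → Σ[ n ] (u i) ≡ 0ℚ) →
    ∑ (Sym n) (λ π → Σ[ n ] (λ i → u i (lookup π i)) * Σ[ n ] (λ i → u i (lookup π i))) ≡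
    (μ₁ + μ₂) * Σ[ n ] (λ i → rowDot i i) - μ₂ * Σ[ n ] (λ j → Σ[ n ] (λ i → u i j) * Σ[ n ] (λ i → u i j))
  ∑-Sym-square Σu≡0 = begin
    ∑ (Sym n) (λ π → Σ[ n ] (λ i → u i (lookup π i)) * Σ[ n ] (λ k → u k (lookup π k)))
      ≡⟨ ∑-cong (Sym n) (λ π → ∑-*-∑ (allFin n) (allFin n) _ _) ⟩
    ∑ (Sym n) (λ π → Σ[ n ] (λ i → Σ[ n ] (λ k → u i (lookup π i) * u k (lookup π k))))
      ≡⟨ trans (∑-comm (Sym n) (allFin n) _) (∑-cong (allFin n) (λ i → ∑-comm (Sym n) (allFin n) _)) ⟩
    Σ[ n ] (λ i → Σ[ n ] (λ k → ∑ (Sym n) (λ π → u i (lookup π i) * u k (lookup π k))))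
      ≡⟨ ∑-cong (allFin n) (λ i → ∑-cong (allFin n) (∑-Sym-rows Σu≡0 i)) ⟩
    Σ[ n ] (λ i → Σ[ n ] (λ k → (μ₁ + μ₂) * (δ i k * rowDot i k) - μ₂ * rowDot i k))
      ≡⟨ ∑-cong (allFin n) (λ i → trans (∑-- (allFin n) _ _)
                                         (cong₂ _-_ (∑-*ˡ (allFin n) (μ₁ + μ₂) _) (∑-*ˡ (allFin n) μ₂ (rowDot i)))) ⟩
    Σ[ n ] (λ i → (μ₁ + μ₂) * Σ[ n ] (λ k → δ i k * rowDot i k) - μ₂ * Σ[ n ] (rowDot i))
      ≡⟨ ∑-cong (allFin n) (λ i → cong (λ d → (μ₁ + μ₂) * d - μ₂ * Σ[ n ] (rowDot i)) (Σ-δˡ n i (rowDot i))) ⟩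
    Σ[ n ] (λ i → (μ₁ + μ₂) * rowDot i i - μ₂ * Σ[ n ] (rowDot i))
      ≡⟨ trans (∑-- (allFin n) _ _) (cong₂ _-_ (∑-*ˡ (allFin n) (μ₁ + μ₂) _) (∑-*ˡ (allFin n) μ₂ _)) ⟩
    (μ₁ + μ₂) * Σ[ n ] (λ i → rowDot i i) - μ₂ * Σ[ n ] (λ i → Σ[ n ] (rowDot i))
      ≡⟨ cong (λ d → (μ₁ + μ₂) * Σ[ n ] (λ i → rowDot i i) - μ₂ * d) Σ-rowDot ⟩
    (μ₁ + μ₂) * Σ[ n ] (λ i → rowDot i i) - μ₂ * Σ[ n ] (λ j → Σ[ n ] (λ i → u i j) * Σ[ n ] (λ i → u i j)) ∎
    where open ≡-Reasoning

  ∑-Sym-square-≤ : (∀ i → Σ[ n ] (u i) ≡ 0ℚ) →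
    ∑ (Sym n) (λ π → Σ[ n ] (λ i → u i (lookup π i)) * Σ[ n ] (λ i → u i (lookup π i))) ≤
    fromℕ ((n ∸ 1) ! ℕ.+ (n ∸ 2) !) * Σ[ n ] (λ i → rowDot i i)
  ∑-Sym-square-≤ Σu≡0 = subst₂ _≤_ (sym (∑-Sym-square Σu≡0))
                                  (cong (_* Σ[ n ] (λ i → rowDot i i)) (sym (fromℕ-+ ((n ∸ 1) !) ((n ∸ 2) !))))
    (p-q≤p ((μ₁ + μ₂) * Σ[ n ] (λ i → rowDot i i))
           (*-nonNeg (+/-nonNeg ((n ∸ 2) !) 1) (∑-nonNeg (allFin n) (λ j → p*p-nonNeg (Σ[ n ] (λ i → u i j))))))

∑-Sym-gFun²-≤ : ∀ n .{{_ : NonZero n}} (a : Fin n → Fin n → ℚ) →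
  ∑ (Sym n) (λ π → gFun n a π * gFun n a π) ≤ fromℕ ((n ∸ 1) ! ℕ.+ (n ∸ 2) !) * Σ[ n ] (λ i → Σ[ n ] (λ j → a i j * a i j))
∑-Sym-gFun²-≤ n a = begin
  ∑ (Sym n) (λ π → gFun n a π * gFun n a π)
    ≡⟨ ∑-cong (Sym n) (λ π → cong₂ _*_ (gFun≡Σ-centre n a π) (gFun≡Σ-centre n a π)) ⟩
  ∑ (Sym n) (λ π → Σ[ n ] (λ i → u i (lookup π i)) * Σ[ n ] (λ i → u i (lookup π i)))
    ≤⟨ ∑-Sym-square-≤ u (Σ-centre n ∘ a) ⟩
  fromℕ K * Σ[ n ] (λ i → Σ[ n ] (λ j → u i j * u i j))
    ≤⟨ *-monoˡ-≤-nonNeg (fromℕ K) {{nonNegative (+/-nonNeg K 1)}} (∑-mono-≤ (allFin n) (λ i → Σ-centre²-≤ n (a i))) ⟩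
  fromℕ K * Σ[ n ] (λ i → Σ[ n ] (λ j → a i j * a i j)) ∎
  where
  open ≤-Reasoning
  u = λ i → centre n (a i)
  K = (n ∸ 1) ! ℕ.+ (n ∸ 2) !

pred-!≤! : ∀ m → (m ∸ 1) ! ℕ.≤ m !
pred-!≤! zero    = ℕ.≤-refl
pred-!≤! (suc m) = ℕ.m≤m+n (m !) (m ℕ.* m !)

factorials-ratio-≤ : ∀ n .{{_ : NonZero n}} → fromℕ ((n ∸ 1) ! ℕ.+ (n ∸ 2) !) * (+ 1 / n !) {{n !≢0}} ≤ + 2 / n
factorials-ratio-≤ n@(suc s) = subst (_≤ + 2 / n) (sym (fromℕ-*-/ K (n !) {{n !≢0}})) (/≤/-cross K 2 (n !) n {{n !≢0}} (begin
  (s ! ℕ.+ (s ∸ 1) !) ℕ.* n  ≤⟨ ℕ.*-monoˡ-≤ n (ℕ.+-monoʳ-≤ (s !) (pred-!≤! s)) ⟩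
  (s ! ℕ.+ s !) ℕ.* n        ≡⟨ solve 2 (λ f m → (f :+ f) :* m := con 2 :* (m :* f)) refl (s !) n ⟩
  2 ℕ.* n !                  ∎))
  where
  open ℕ.≤-Reasoning
  open ℕ-Solver
  K = s ! ℕ.+ (s ∸ 1) !

lemma3p3 : (n : ℕ) .{{_ : NonZero n}} (a : Fin n → Fin n → ℚ) →
    norm2² n (gFun n a) ≤ (+ 8 / n) * (Σ[ n ] (λ i → Σ[ n ] (λ j → a i j * a i j)))
lemma3p3 n a = begin
  ∑ (Sym n) (λ π → gFun n a π * gFun n a π) * d  ≤⟨ *-monoʳ-≤-nonNeg d (∑-Sym-gFun²-≤ n a) ⟩
  fromℕ K * X * d                                ≡⟨ solve 3 (λ k x d → k :* x :* d := k :* d :* x) refl (fromℕ K) X d ⟩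
  fromℕ K * d * X                                ≤⟨ *-monoʳ-≤-nonNeg X (factorials-ratio-≤ n) ⟩
  + 2 / n * X                                    ≤⟨ *-monoʳ-≤-nonNeg X (/≤/-cross 2 8 n n (ℕ.*-monoˡ-≤ n (ℕ.m≤m+n 2 6))) ⟩
  + 8 / n * X                                    ∎
  where
  open ≤-Reasoning
  open ℚ-Solver
  d = (+ 1 / n !) {{n !≢0}}
  K = (n ∸ 1) ! ℕ.+ (n ∸ 2) !
  X = Σ[ n ] (λ i → Σ[ n ] (λ j → a i j * a i j))
  instance
    d-nonNeg : NonNegative d
    d-nonNeg = nonNegative (+/-nonNeg 1 (n !) {{n !≢0}})
    X-nonNeg : NonNegative X
    X-nonNeg = nonNegative (∑-nonNeg (allFin n) (λ i → ∑-nonNeg (allFin n) (λ j → p*p-nonNeg (a i j))))
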